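{- There exists a universal constant $C_1$ such that for all positive integers $n,k,r$ with $k,r\ge 2$, \[\left|\mathbb E[M_{n,k,r}]-\frac{\log n}{(r-1)\log k}\right|\le C_1,\] where $M_{n,k,r}$ is the maximum length of an $r$-power in a uniformly random word of length $n$ over the alphabet $[k]=\{1,\dots,k\}$.
   Context: For a word $w=w_1\cdots w_n$ and positive integers $r,m$, an $r$-power of length $m$ in $w$ is a contiguous factor $w_i\cdots w_{i+rm-1}$ (with $i+rm-1\le n$) that is the concatenation of $r$ identical consecutive blocks each of length $m$, i.e. $w_j=w_{j+m}$ for all $i\le j\le i+(r-1)m-1$. The maximum length of an $r$-power in $w$ is the largest such $m$ (and $0$ if none exists). The random word is uniform over $[k]^n$; $\log$ is the natural logarithm. -}

module Defs where

open import Data.Nat using (ℕ; zero; suc; _+_; _*_; _∸_; _^_; _≤ᵇ_; _⊔_)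
open import Data.Bool using (Bool; true; false; _∧_)
open import Data.Fin using (Fin)
import Data.Fin.Properties as FinP
open import Data.Vec using (Vec; []; _∷_)
open import Data.List using (List; []; _∷_; [_]; map; concatMap; allFin; upTo; foldr)
open import Data.Nat.ListAction using (sum)
open import Data.Bool.ListAction using (all; any)
open import Data.Maybe using (Maybe; just; nothing)
open import Relation.Nullary.Decidable using (⌊_⌋)

Word : ℕ → ℕ → Set
Word n k = Vec (Fin k) n

allWords : (n k : ℕ) → List (Word n k)
allWords zero    k = [ [] ]
allWords (suc n) k = concatMap (λ a → map (a ∷_) (allWords n k)) (allFin k)

letterAt : ∀ {k n} → Word n k → ℕ → Maybe (Fin k)
letterAt []       _       = nothing
letterAt (a ∷ w)  zero    = just a
letterAt (a ∷ w)  (suc j) = letterAt w j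

sameLetter : ∀ {k} → Maybe (Fin k) → Maybe (Fin k) → Bool
sameLetter (just a) (just b) = ⌊ a FinP.≟ b ⌋
sameLetter _        _        = false

range : ℕ → ℕ → List ℕ
range i len = map (i +_) (upTo len)

isRPowerAt : ∀ {k n} → Word n k → (r m i : ℕ) → Bool
isRPowerAt {n = n} w r m i =
  ((i + r * m) ≤ᵇ n) ∧ all (λ j → sameLetter (letterAt w j) (letterAt w (j + m))) (range i ((r ∸ 1) * m))

hasRPower : ∀ {k n} → Word n k → (r m : ℕ) → Bool
hasRPower {n = n} w r m = any (isRPowerAt w r m) (upTo (suc n))

-- Maximum length of an r-power in w (0 if none); any r-power with r ≥ 1 has m ≤ n.
maxRPowerLength : ∀ {k n} → Word n k → ℕ → ℕ
maxRPowerLength {n = n} w r =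
  foldr _⊔_ 0 (map (λ m → if′ hasRPower w r m then m else 0) (upTo (suc n)))
  where
  if′_then_else_ : Bool → ℕ → ℕ → ℕ
  if′ true  then a else b = a
  if′ false then a else b = b

-- Σ_{w ∈ [k]^n} M(w), so that E[M_{n,k,r}] = totalMaxRPower n k r / k ^ n.
totalMaxRPower : (n k r : ℕ) → ℕ
totalMaxRPower n k r = sum (map (λ w → maxRPowerLength w r) (allWords n k))

-- Write s = r - 1, D = k ^ n, S = Σ_w M(w) (so E[M] = S / D) and let L be the integer with
-- k ^ (s L) ≤ n < k ^ (s (L + 1)), i.e. L = ⌊log n / (s log k)⌋. Both inequalities follow from
-- D L - 16 D ≤ S ≤ D L + 4 D.
--
-- Upper bound: an r-power of length m at a fixed position prescribes s m letters, so by the union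
-- bound at most (n + 1) D / k ^ (s m) words contain one; for m = L + 1 + j this is at most D / 2 ^ j.
-- Since M ≤ L + Σ_m (m - L) [w has an r-power of length m], the excess over D L is at most
-- Σ_j (1 + j) D / 2 ^ j = 4 D.
--
-- Lower bound: cut the word into blocks of length (2 + s) m. A block contains an r-power of length
-- m with probability at least m / (2 k ^ (s m)), witnessed by m pairwise exclusive events, and
-- blocks are independent; a Bernoulli-type inequality then bounds the number of words without an
-- r-power of length m by 2 (2 + s) k ^ (s m) D / n, which is at most 8 D / 2 ^ j for m = L - j.
-- Since L ≤ M + #{m ≤ L | w has no r-power of length m}, the deficit below D L is at most 16 D.

module Submission where

open import Data.Bool using (Bool; true; false; T; not; _∧_)
open import Data.Bool.ListAction using (any)
open import Data.Bool.Properties using (T-∧)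
open import Data.Empty using (⊥; ⊥-elim)
open import Data.Fin using (Fin; zero; suc)
import Data.Fin.Properties as Fin
open import Data.List using (List; []; _∷_; map; foldr; applyUpTo; upTo; concatMap; tabulate; allFin; length; replicate)
import Data.List.Properties as List using (map-++; map-∘; map-cong; length-replicate)
open import Data.List.Relation.Unary.All.Properties using (all⁺; all⁻; map⁺; map⁻; applyUpTo⁺₁; applyUpTo⁻)
import Data.List.Relation.Unary.Any.Properties as Any
open import Data.Maybe using (just)
open import Data.Nat
open import Data.Nat.DivMod using (_/_; _%_; m≡m%n+[m/n]*n; m%n<n)
import Data.Nat.ListAction as List using (sum; product)
import Data.Nat.ListAction.Properties as List using (sum-++)
open import Data.Nat.Properties
open import Algebra.Properties.Semiring.Sum +-*-semiring
  using (sum; sum-cong-≗; ∑-comm; *-distribˡ-sum; *-distribʳ-sum) renaming (∑-distrib-+ to sum-distrib-+)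
open import Data.Nat.Solver using (module +-*-Solver)
open import Data.Product using (_×_; _,_; proj₁; proj₂; ∃-syntax; Σ-syntax)
open import Data.Unit using (tt)
open import Data.Vec using ([]; _∷_; _++_)
open import Defs
open import Function using (_∘_; id; _⟨_⟩_)
open import Function.Bundles using (Equivalence)
open import Relation.Binary.PropositionalEquality
open import Relation.Nullary using (¬_; yes; no)
open import Relation.Nullary.Decidable using (⌊_⌋; ⌊⌋-map′)

open +-*-Solver using (solve; _:+_; _:*_; _:=_; con)

ind : Bool → ℕ
ind true  = 1
ind false = 0

ind≤1 : ∀ b → ind b ≤ 1
ind≤1 true  = ≤-refl
ind≤1 false = z≤n

ind-∧ : ∀ a b → ind (a ∧ b) ≡ ind a * ind b
ind-∧ true  b = sym (+-identityʳ (ind b))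
ind-∧ false b = refl

ind-not : ∀ b → ind (not b) + ind b ≡ 1
ind-not true  = refl
ind-not false = refl

ind-mono : ∀ {a b} → (T a → T b) → ind a ≤ ind b
ind-mono {false}        _   = z≤n
ind-mono {true} {true}  _   = ≤-refl
ind-mono {true} {false} a⇒b = ⊥-elim (a⇒b tt)

T-not⇒¬T : ∀ {b} → T (not b) → ¬ T b
T-not⇒¬T {true} () _

T-not-mono : ∀ {a b} → (T a → T b) → T (not b) → T (not a)
T-not-mono {false}        _   _ = tt
T-not-mono {true} {false} a⇒b _ = a⇒b tt

-- Sums over initial segments of ℕ

∑< : ℕ → (ℕ → ℕ) → ℕ
∑< zero    f = 0
∑< (suc n) f = f 0 + ∑< n (f ∘ suc)

syntax ∑< n (λ i → e) = ∑[ i < n ] e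

∑-cong : ∀ n {f g : ℕ → ℕ} → (∀ {i} → i < n → f i ≡ g i) → ∑[ i < n ] f i ≡ ∑[ i < n ] g i
∑-cong zero    f≡g = refl
∑-cong (suc n) f≡g = cong₂ _+_ (f≡g z<s) (∑-cong n (f≡g ∘ s<s))

∑-mono : ∀ n {f g : ℕ → ℕ} → (∀ {i} → i < n → f i ≤ g i) → ∑[ i < n ] f i ≤ ∑[ i < n ] g i
∑-mono zero    f≤g = z≤n
∑-mono (suc n) f≤g = +-mono-≤ (f≤g z<s) (∑-mono n (f≤g ∘ s<s))

∑-const : ∀ n c → ∑[ i < n ] c ≡ n * c
∑-const zero    c = refl
∑-const (suc n) c = cong (c +_) (∑-const n c)

*-distribˡ-∑ : ∀ n c (f : ℕ → ℕ) → c * ∑[ i < n ] f i ≡ ∑[ i < n ] (c * f i)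
*-distribˡ-∑ zero    c f = *-zeroʳ c
*-distribˡ-∑ (suc n) c f = trans (*-distribˡ-+ c (f 0) _) (cong (c * f 0 +_) (*-distribˡ-∑ n c (f ∘ suc)))

*-distribʳ-∑ : ∀ n c (f : ℕ → ℕ) → (∑[ i < n ] f i) * c ≡ ∑[ i < n ] (f i * c)
*-distribʳ-∑ n c f = trans (*-comm _ c) (trans (*-distribˡ-∑ n c f) (∑-cong n (λ {i} _ → *-comm c (f i))))

∑-last : ∀ n (f : ℕ → ℕ) → ∑[ i < suc n ] f i ≡ ∑[ i < n ] f i + f n
∑-last zero    f = +-comm (f 0) 0
∑-last (suc n) f = trans (cong (f 0 +_) (∑-last n (f ∘ suc))) (sym (+-assoc (f 0) _ _))

ind-any≤∑ : ∀ (p : ℕ → Bool) f N → ind (any p (applyUpTo f N)) ≤ ∑[ i < N ] ind (p (f i))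
ind-any≤∑ p f zero    = z≤n
ind-any≤∑ p f (suc N) with p (f 0)
... | true  = s≤s z≤n
... | false = ind-any≤∑ p (f ∘ suc) N

∑-ind-disjoint : ∀ N (p : ℕ → Bool) {q : Bool} →
                 (∀ {i} → i < N → T (p i) → T q) →
                 (∀ {i j} → i < j → j < N → T (p i) → T (p j) → ⊥) →
                 ∑[ i < N ] ind (p i) ≤ ind q
∑-ind-disjoint zero    p p⇒q disjoint = z≤n
∑-ind-disjoint (suc N) p p⇒q disjoint with p 0 in p0
... | false = ∑-ind-disjoint N (p ∘ suc) (p⇒q ∘ s<s) (λ i<j j<N → disjoint (s<s i<j) (s<s j<N))
... | true  = +-monoʳ-≤ 1 rest≤0 ⟨ ≤-trans ⟩ ind-mono {true} (λ _ → p⇒q z<s p0ᵀ)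
  where
  p0ᵀ : T (p 0)
  p0ᵀ = subst T (sym p0) tt
  rest≤0 : ∑[ i < N ] ind (p (suc i)) ≤ 0
  rest≤0 = ∑-mono N (λ i<N → ind-mono {b = false} (disjoint z<s (s<s i<N) p0ᵀ))
           ⟨ ≤-trans ⟩ ≤-reflexive (trans (∑-const N 0) (*-zeroʳ N))

≤-foldr-⊔ : ∀ (g f : ℕ → ℕ) N {i} → i < N → g (f i) ≤ foldr _⊔_ 0 (map g (applyUpTo f N))
≤-foldr-⊔ g f (suc N) {zero}  _         = m≤m⊔n _ _
≤-foldr-⊔ g f (suc N) {suc i} (s≤s i<N) = ≤-foldr-⊔ g (f ∘ suc) N i<N ⟨ ≤-trans ⟩ m≤n⊔m _ _

foldr-⊔≤ : ∀ (g f : ℕ → ℕ) N L → foldr _⊔_ 0 (map g (applyUpTo f N)) ≤ L + ∑[ i < N ] (g (f i) ∸ L)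
foldr-⊔≤ g f zero    L = z≤n
foldr-⊔≤ g f (suc N) L = ⊔-lub
  (m≤n+m∸n (g (f 0)) L ⟨ ≤-trans ⟩ +-monoʳ-≤ L (m≤m+n _ _))
  (foldr-⊔≤ g (f ∘ suc) N L ⟨ ≤-trans ⟩ +-monoʳ-≤ L (m≤n+m _ _))

∑-weighted-geometric : ∀ J c (a : ℕ → ℕ) {E} → (∀ j → a j * 2 ^ j ≤ E) →
                       ∑[ j < J ] ((c + j) * a j) ≤ (2 * c + 2) * E
∑-weighted-geometric zero    c a h = z≤n
∑-weighted-geometric (suc J) c a {E} h = *-cancelˡ-≤ 2 (begin
  2 * ((c + 0) * a 0 + tail)                                         ≡⟨ *-distribˡ-+ 2 ((c + 0) * a 0) tail ⟩
  2 * ((c + 0) * a 0) + 2 * tail                                     ≡⟨ cong (2 * ((c + 0) * a 0) +_) doubled ⟨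
  2 * ((c + 0) * a 0) + ∑[ j < J ] ((suc c + j) * (2 * a (suc j)))   ≤⟨ +-mono-≤ (*-monoʳ-≤ 2 (*-monoʳ-≤ (c + 0) a0≤E))
                                                                                 (∑-weighted-geometric J (suc c) (λ j → 2 * a (suc j)) h′) ⟩
  2 * ((c + 0) * E) + (2 * suc c + 2) * E                            ≡⟨ solve 2 (λ c E → con 2 :* ((c :+ con 0) :* E)
                                                                                           :+ (con 2 :* (con 1 :+ c) :+ con 2) :* E
                                                                                         := con 2 :* ((con 2 :* c :+ con 2) :* E))
                                                                                 refl c E ⟩
  2 * ((2 * c + 2) * E)                                              ∎)
  where
  open ≤-Reasoning
  tail : ℕ
  tail = ∑[ j < J ] ((c + suc j) * a (suc j))
  a0≤E : a 0 ≤ E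
  a0≤E = ≤-reflexive (sym (*-identityʳ (a 0))) ⟨ ≤-trans ⟩ h 0
  h′ : ∀ j → 2 * a (suc j) * 2 ^ j ≤ E
  h′ j = ≤-reflexive (solve 2 (λ x p → con 2 :* x :* p := x :* (con 2 :* p)) refl (a (suc j)) (2 ^ j)) ⟨ ≤-trans ⟩ h (suc j)
  doubled : ∑[ j < J ] ((suc c + j) * (2 * a (suc j))) ≡ 2 * tail
  doubled = trans (∑-cong J (λ {j} _ → solve 3 (λ c j x → (con 1 :+ c :+ j) :* (con 2 :* x) := con 2 :* ((c :+ (con 1 :+ j)) :* x))
                                                 refl c j (a (suc j))))
                  (sym (*-distribˡ-∑ J 2 _))

∑-∸-geometric : ∀ L N (a : ℕ → ℕ) {E} → (∀ j → a (suc L + j) * 2 ^ j ≤ E) → ∑[ m < N ] ((m ∸ L) * a m) ≤ 4 * E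
∑-∸-geometric L       zero    a h = z≤n
∑-∸-geometric zero    (suc N) a h = ∑-weighted-geometric N 1 (a ∘ suc) h
∑-∸-geometric (suc L) (suc N) a h = ∑-∸-geometric L N (a ∘ suc) h

∑-geometric-reversed : ∀ L (a : ℕ → ℕ) {E} → (∀ {i} → i < L → a i * 2 ^ (L ∸ suc i) ≤ E) → ∑[ i < L ] a i ≤ 2 * E
∑-geometric-reversed zero    a h = z≤n
∑-geometric-reversed (suc L) a {E} h = begin
  ∑[ i < suc L ] a i    ≡⟨ ∑-last L a ⟩
  ∑[ i < L ] a i + a L  ≤⟨ +-mono-≤ front last ⟩
  E + E                 ≡⟨ cong (E +_) (+-identityʳ E) ⟨
  2 * E                 ∎
  where
  open ≤-Reasoning
  doubled : ∀ {i} → i < L → 2 * a i * 2 ^ (L ∸ suc i) ≤ E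
  doubled {i} i<L = ≤-reflexive (solve 2 (λ x p → con 2 :* x :* p := x :* (con 2 :* p)) refl (a i) (2 ^ (L ∸ suc i)))
                    ⟨ ≤-trans ⟩ subst (λ e → a i * 2 ^ e ≤ E) (+-∸-assoc 1 i<L) (h (m<n⇒m<1+n i<L))
  front : ∑[ i < L ] a i ≤ E
  front = *-cancelˡ-≤ 2 (≤-reflexive (*-distribˡ-∑ L 2 a) ⟨ ≤-trans ⟩ ∑-geometric-reversed L (λ i → 2 * a i) doubled)
  last : a L ≤ E
  last = ≤-reflexive (trans (sym (*-identityʳ (a L))) (cong (λ e → a L * 2 ^ e) (sym (n∸n≡0 L)))) ⟨ ≤-trans ⟩ h ≤-refl

bernoulli-step : ∀ {X Y a b c} → 0 < b → X * b + a * Y ≤ Y * b → b ≤ c → X * (c + a) ≤ Y * c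
bernoulli-step {X} {Y} {a} {b} {c} b>0 hyp b≤c =
  *-cancelʳ-≤ (X * (c + a)) (Y * c) b {{>-nonZero b>0}} (+-cancelʳ-≤ (a * Y * b) _ _ (begin
    X * (c + a) * b + a * Y * b        ≤⟨ +-monoʳ-≤ (X * (c + a) * b) (*-monoʳ-≤ (a * Y) (b≤c ⟨ ≤-trans ⟩ m≤m+n c a)) ⟩
    X * (c + a) * b + a * Y * (c + a)  ≡⟨ solve 5 (λ X Y a b c → X :* (c :+ a) :* b :+ a :* Y :* (c :+ a)
                                                             := (X :* b :+ a :* Y) :* (c :+ a)) refl X Y a b c ⟩
    (X * b + a * Y) * (c + a)          ≤⟨ *-monoˡ-≤ (c + a) hyp ⟩
    Y * b * (c + a)                    ≡⟨ solve 5 (λ X Y a b c → Y :* b :* (c :+ a) := Y :* c :* b :+ a :* Y :* b) refl X Y a b c ⟩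
    Y * c * b + a * Y * b              ∎))
  where open ≤-Reasoning

-- In ℕ: if X / Y ≤ 1 - a / b then (X / Y) ^ q ≤ 1 / (1 + q a / b).
bernoulli : ∀ {X Y a b} → 0 < b → X * b + a * Y ≤ Y * b → ∀ q → X ^ q * (b + q * a) ≤ Y ^ q * b
bernoulli {b = b} b>0 hyp zero = ≤-reflexive (cong (1 *_) (+-identityʳ b))
bernoulli {X} {Y} {a} {b} b>0 hyp (suc q) = begin
  X * X ^ q * (b + (a + q * a))  ≡⟨ solve 5 (λ X P a b qa → X :* P :* (b :+ (a :+ qa)) := P :* (X :* ((b :+ qa) :+ a)))
                                            refl X (X ^ q) a b (q * a) ⟩
  X ^ q * (X * (b + q * a + a))  ≤⟨ *-monoʳ-≤ (X ^ q) (bernoulli-step {X} {Y} {a} b>0 hyp (m≤m+n b (q * a))) ⟩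
  X ^ q * (Y * (b + q * a))      ≡⟨ solve 3 (λ P Y c → P :* (Y :* c) := Y :* (P :* c)) refl (X ^ q) Y (b + q * a) ⟩
  Y * (X ^ q * (b + q * a))      ≤⟨ *-monoʳ-≤ Y (bernoulli {X} {Y} {a} b>0 hyp q) ⟩
  Y * (Y ^ q * b)                ≡⟨ *-assoc Y (Y ^ q) b ⟨
  Y * Y ^ q * b                  ∎
  where open ≤-Reasoning

n<2^n : ∀ n → n < 2 ^ n
n<2^n zero    = z<s
n<2^n (suc n) = begin-strict
  suc n          ≡⟨ +-comm 1 n ⟩
  n + 1          <⟨ +-mono-<-≤ (n<2^n n) (m^n>0 2 n) ⟩
  2 ^ n + 2 ^ n  ≡⟨ cong (2 ^ n +_) (+-identityʳ (2 ^ n)) ⟨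
  2 ^ suc n      ∎
  where open ≤-Reasoning

^-bracket : ∀ b → 2 ≤ b → ∀ n → 1 ≤ n → ∃[ L ] b ^ L ≤ n × n < b ^ suc L
^-bracket b 2≤b n 1≤n = search n (n<2^n n ⟨ <-≤-trans ⟩ ^-monoˡ-≤ n 2≤b)
  where
  search : ∀ t → n < b ^ t → ∃[ L ] b ^ L ≤ n × n < b ^ suc L
  search zero    n<1 = ⊥-elim (<-irrefl refl (n<1 ⟨ <-≤-trans ⟩ 1≤n))
  search (suc t) n<b^[1+t] with n <? b ^ t
  ... | yes n<b^t = search t n<b^t
  ... | no  n≮b^t = t , ≮⇒≥ n≮b^t , n<b^[1+t]

-- Sums over letters and over words

sum-mono : ∀ {k} {f g : Fin k → ℕ} → (∀ x → f x ≤ g x) → sum f ≤ sum g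
sum-mono {zero}  f≤g = z≤n
sum-mono {suc k} f≤g = +-mono-≤ (f≤g zero) (sum-mono (f≤g ∘ suc))

sum-const : ∀ k c → sum {k} (λ _ → c) ≡ k * c
sum-const zero    c = refl
sum-const (suc k) c = cong (c +_) (sum-const k c)

sum-ind-≡ : ∀ {k} (y : Fin k) → sum (λ x → ind ⌊ x Fin.≟ y ⌋) ≡ 1
sum-ind-≡ {suc k} zero    = cong suc (trans (sum-const k 0) (*-zeroʳ k))
sum-ind-≡ {suc k} (suc y) =
  trans (sum-cong-≗ (λ x → cong ind (⌊⌋-map′ (cong suc) Fin.suc-injective (x Fin.≟ y)))) (sum-ind-≡ y)

sum-ind-≢ : ∀ {k} (y : Fin k) → sum (λ x → ind (not ⌊ x Fin.≟ y ⌋)) ≡ k ∸ 1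
sum-ind-≢ {suc k}       zero    = trans (sum-const k 1) (*-identityʳ k)
sum-ind-≢ {suc (suc k)} (suc y) =
  cong suc (trans (sum-cong-≗ (λ x → cong (ind ∘ not) (⌊⌋-map′ (cong suc) Fin.suc-injective (x Fin.≟ y)))) (sum-ind-≢ y))

module _ {k : ℕ} where

  wordSum : ∀ n → (Word n k → ℕ) → ℕ
  wordSum zero    f = f []
  wordSum (suc n) f = sum (λ x → wordSum n (λ w → f (x ∷ w)))

  count : ∀ n → (Word n k → Bool) → ℕ
  count n P = wordSum n (ind ∘ P)

  wordSum-cong : ∀ n {f g : Word n k → ℕ} → (∀ w → f w ≡ g w) → wordSum n f ≡ wordSum n g
  wordSum-cong zero    f≡g = f≡g []
  wordSum-cong (suc n) f≡g = sum-cong-≗ (λ x → wordSum-cong n (λ w → f≡g (x ∷ w)))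

  wordSum-mono : ∀ n {f g : Word n k → ℕ} → (∀ w → f w ≤ g w) → wordSum n f ≤ wordSum n g
  wordSum-mono zero    f≤g = f≤g []
  wordSum-mono (suc n) f≤g = sum-mono (λ x → wordSum-mono n (λ w → f≤g (x ∷ w)))

  wordSum-distrib-+ : ∀ n (f g : Word n k → ℕ) → wordSum n (λ w → f w + g w) ≡ wordSum n f + wordSum n g
  wordSum-distrib-+ zero    f g = refl
  wordSum-distrib-+ (suc n) f g =
    trans (sum-cong-≗ (λ x → wordSum-distrib-+ n (λ w → f (x ∷ w)) (λ w → g (x ∷ w))))
          (sum-distrib-+ {k} (λ x → wordSum n (λ w → f (x ∷ w))) (λ x → wordSum n (λ w → g (x ∷ w))))

  *-distribˡ-wordSum : ∀ n c (f : Word n k → ℕ) → c * wordSum n f ≡ wordSum n (λ w → c * f w)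
  *-distribˡ-wordSum zero    c f = refl
  *-distribˡ-wordSum (suc n) c f =
    trans (*-distribˡ-sum {k} c (λ x → wordSum n (λ w → f (x ∷ w)))) (sum-cong-≗ (λ x → *-distribˡ-wordSum n c (λ w → f (x ∷ w))))

  wordSum-const : ∀ n c → wordSum n (λ (_ : Word n k) → c) ≡ k ^ n * c
  wordSum-const zero    c = sym (+-identityʳ c)
  wordSum-const (suc n) c =
    trans (sum-cong-≗ {k} (λ _ → wordSum-const n c)) (trans (sum-const k (k ^ n * c)) (sym (*-assoc k (k ^ n) c)))

  wordSum-∑ : ∀ n N (f : ℕ → Word n k → ℕ) → wordSum n (λ w → ∑[ i < N ] f i w) ≡ ∑[ i < N ] wordSum n (f i)
  wordSum-∑ n zero    f = trans (wordSum-const n 0) (*-zeroʳ (k ^ n))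
  wordSum-∑ n (suc N) f = trans (wordSum-distrib-+ n (f 0) _) (cong (wordSum n (f 0) +_) (wordSum-∑ n N (f ∘ suc)))

  wordSum-sum : ∀ n (f : Fin k → Word n k → ℕ) → wordSum n (λ w → sum (λ x → f x w)) ≡ sum (λ x → wordSum n (f x))
  wordSum-sum zero    f = refl
  wordSum-sum (suc n) f =
    trans (sum-cong-≗ (λ y → wordSum-sum n (λ x w → f x (y ∷ w)))) (∑-comm {k} {k} (λ y x → wordSum n (λ w → f x (y ∷ w))))

  wordSum-++ : ∀ a b (f : Word (a + b) k → ℕ) → wordSum (a + b) f ≡ wordSum a (λ u → wordSum b (λ v → f (u ++ v)))
  wordSum-++ zero    b f = refl
  wordSum-++ (suc a) b f = sum-cong-≗ (λ x → wordSum-++ a b (λ w → f (x ∷ w)))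

  wordSum-* : ∀ a b (f : Word a k → ℕ) (g : Word b k → ℕ) →
              wordSum a (λ u → wordSum b (λ v → f u * g v)) ≡ wordSum a f * wordSum b g
  wordSum-* a b f g = begin
    wordSum a (λ u → wordSum b (λ v → f u * g v))  ≡⟨ wordSum-cong a (λ u → *-distribˡ-wordSum b (f u) g) ⟨
    wordSum a (λ u → f u * wordSum b g)            ≡⟨ wordSum-cong a (λ u → *-comm (f u) (wordSum b g)) ⟩
    wordSum a (λ u → wordSum b g * f u)            ≡⟨ *-distribˡ-wordSum a (wordSum b g) f ⟨
    wordSum b g * wordSum a f                      ≡⟨ *-comm (wordSum b g) (wordSum a f) ⟩
    wordSum a f * wordSum b g                      ∎
    where open ≡-Reasoning

  count≤ : ∀ n (P : Word n k → Bool) → count n P ≤ k ^ n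
  count≤ n P = wordSum-mono n (ind≤1 ∘ P) ⟨ ≤-trans ⟩ ≤-reflexive (trans (wordSum-const n 1) (*-identityʳ (k ^ n)))

  count-not : ∀ n (P : Word n k → Bool) → count n (not ∘ P) + count n P ≡ k ^ n
  count-not n P = begin
    count n (not ∘ P) + count n P                   ≡⟨ wordSum-distrib-+ n _ _ ⟨
    wordSum n (λ w → ind (not (P w)) + ind (P w))   ≡⟨ wordSum-cong n (ind-not ∘ P) ⟩
    wordSum n (λ _ → 1)                             ≡⟨ wordSum-const n 1 ⟩
    k ^ n * 1                                       ≡⟨ *-identityʳ (k ^ n) ⟩
    k ^ n                                           ∎
    where open ≡-Reasoning

sum-map-concatMap : ∀ {A B : Set} (f : B → ℕ) (h : A → List B) xs →
                    List.sum (map f (concatMap h xs)) ≡ List.sum (map (λ x → List.sum (map f (h x))) xs)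
sum-map-concatMap f h []       = refl
sum-map-concatMap f h (x ∷ xs) =
  trans (cong List.sum (List.map-++ f (h x) _))
        (trans (List.sum-++ (map f (h x)) _) (cong (List.sum (map f (h x)) +_) (sum-map-concatMap f h xs)))

sum-map-tabulate : ∀ {A : Set} n (g : A → ℕ) (h : Fin n → A) → List.sum (map g (tabulate h)) ≡ sum (g ∘ h)
sum-map-tabulate zero    g h = refl
sum-map-tabulate (suc n) g h = cong (g (h zero) +_) (sum-map-tabulate n g (h ∘ suc))

sum-allWords : ∀ {k} n (f : Word n k → ℕ) → List.sum (map f (allWords n k)) ≡ wordSum n f
sum-allWords         zero    f = +-identityʳ (f [])
sum-allWords {k = k} (suc n) f = begin
  List.sum (map f (concatMap (λ x → map (x ∷_) (allWords n k)) (allFin k)))        ≡⟨ sum-map-concatMap f _ (allFin k) ⟩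
  List.sum (map (λ x → List.sum (map f (map (x ∷_) (allWords n k)))) (allFin k))  ≡⟨ sum-map-tabulate k _ id ⟩
  sum (λ x → List.sum (map f (map (x ∷_) (allWords n k))))                        ≡⟨ sum-cong-≗ {k} (λ x → prefixed x) ⟩
  wordSum (suc n) f                                                                ∎
  where
  open ≡-Reasoning
  prefixed : ∀ x → List.sum (map f (map (x ∷_) (allWords n k))) ≡ wordSum n (λ w → f (x ∷ w))
  prefixed x = trans (cong List.sum (sym (List.map-∘ (allWords n k)))) (sum-allWords n (λ w → f (x ∷ w)))

-- Periodicity and r-powers

<[r∸1]*m⇒+m<r*m : ∀ r m {d} → d < (r ∸ 1) * m → d + m < r * m
<[r∸1]*m⇒+m<r*m (suc s) m d<sm = +-monoˡ-< m d<sm ⟨ <-≤-trans ⟩ ≤-reflexive (+-comm (s * m) m)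

module _ {k : ℕ} where

  agreesAt : ∀ {n} → ℕ → Word n k → ℕ → Bool
  agreesAt m w j = sameLetter (letterAt w j) (letterAt w (j + m))

  record RPowerAt {n} (w : Word n k) (r m i : ℕ) : Set where
    constructor _,_
    field
      fits   : i + r * m ≤ n
      agrees : ∀ {d} → d < (r ∸ 1) * m → T (agreesAt m w (i + d))

  isRPowerAt⁺ : ∀ {n} {w : Word n k} {r m i} → RPowerAt w r m i → T (isRPowerAt w r m i)
  isRPowerAt⁺ (fits , agrees) = Equivalence.from T-∧ (≤⇒≤ᵇ fits , all⁻ _ (map⁺ (applyUpTo⁺₁ id _ agrees)))

  isRPowerAt⁻ : ∀ {n} (w : Word n k) r m i → T (isRPowerAt w r m i) → RPowerAt w r m i
  isRPowerAt⁻ w r m i t with fits , agrees ← Equivalence.to T-∧ t =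
    ≤ᵇ⇒≤ _ _ fits , applyUpTo⁻ id _ (map⁻ (all⁺ _ _ agrees))

  hasRPower⁺ : ∀ {n} {w : Word n k} {r m i} → RPowerAt w r m i → T (hasRPower w r m)
  hasRPower⁺ {i = i} p = Any.any⁺ _ (Any.applyUpTo⁺ id (isRPowerAt⁺ p) (s≤s (m≤m+n i _ ⟨ ≤-trans ⟩ RPowerAt.fits p)))

  hasRPower⁻ : ∀ {n} (w : Word n k) r m → T (hasRPower w r m) → ∃[ i ] RPowerAt w r m i
  hasRPower⁻ {n} w r m t with i , _ , p ← Any.applyUpTo⁻ id (Any.any⁻ _ (upTo (suc n)) t) = i , isRPowerAt⁻ w r m i p

  letterAt-++ˡ : ∀ {a b} (u : Word a k) (v : Word b k) {j} → j < a → letterAt (u ++ v) j ≡ letterAt u j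
  letterAt-++ˡ (x ∷ u) v {zero}  _         = refl
  letterAt-++ˡ (x ∷ u) v {suc j} (s≤s j<a) = letterAt-++ˡ u v j<a

  letterAt-++ʳ : ∀ {a b} (u : Word a k) (v : Word b k) j → letterAt (u ++ v) (a + j) ≡ letterAt v j
  letterAt-++ʳ []      v j = refl
  letterAt-++ʳ (x ∷ u) v j = letterAt-++ʳ u v j

  letterAt-just : ∀ {n} (w : Word n k) {j} → j < n → ∃[ x ] letterAt w j ≡ just x
  letterAt-just (x ∷ w) {zero}  _         = x , refl
  letterAt-just (x ∷ w) {suc j} (s≤s j<n) = letterAt-just w j<n

  agreesAt-++ˡ : ∀ {a b} m (u : Word a k) (v : Word b k) {j} → j + m < a → agreesAt m (u ++ v) j ≡ agreesAt m u j
  agreesAt-++ˡ m u v {j} j+m<a =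
    cong₂ sameLetter (letterAt-++ˡ u v (m≤m+n (suc j) m ⟨ ≤-trans ⟩ j+m<a)) (letterAt-++ˡ u v j+m<a)

  agreesAt-++ʳ : ∀ {a b} m (u : Word a k) (v : Word b k) j → agreesAt m (u ++ v) (a + j) ≡ agreesAt m v j
  agreesAt-++ʳ {a} m u v j =
    cong₂ sameLetter (letterAt-++ʳ u v j) (trans (cong (letterAt (u ++ v)) (+-assoc a j m)) (letterAt-++ʳ u v (j + m)))

  RPowerAt-++ˡ : ∀ {a b} {u : Word a k} (v : Word b k) {r m i} → RPowerAt u r m i → RPowerAt (u ++ v) r m i
  RPowerAt-++ˡ {a} {b} {u} v {r} {m} {i} (fits , agrees) = (fits ⟨ ≤-trans ⟩ m≤m+n a b) , agrees′
    where
    agrees′ : ∀ {d} → d < (r ∸ 1) * m → T (agreesAt m (u ++ v) (i + d))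
    agrees′ {d} d<l = subst T (sym (agreesAt-++ˡ m u v inside)) (agrees d<l)
      where
      inside : i + d + m < a
      inside = ≤-reflexive (cong suc (+-assoc i d m)) ⟨ ≤-trans ⟩ +-monoʳ-< i (<[r∸1]*m⇒+m<r*m r m d<l) ⟨ <-≤-trans ⟩ fits

  RPowerAt-++ʳ : ∀ {a b} (u : Word a k) {v : Word b k} {r m i} → RPowerAt v r m i → RPowerAt (u ++ v) r m (a + i)
  RPowerAt-++ʳ {a} u {v} {r} {m} {i} (fits , agrees) = (≤-reflexive (+-assoc a i _) ⟨ ≤-trans ⟩ +-monoʳ-≤ a fits) , agrees′
    where
    agrees′ : ∀ {d} → d < (r ∸ 1) * m → T (agreesAt m (u ++ v) (a + i + d))
    agrees′ {d} d<l =
      subst T (sym (trans (cong (agreesAt m (u ++ v)) (+-assoc a i d)) (agreesAt-++ʳ m u v (i + d)))) (agrees d<l)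

  hasRPower-++ˡ : ∀ {a b} (u : Word a k) (v : Word b k) r m → T (hasRPower u r m) → T (hasRPower (u ++ v) r m)
  hasRPower-++ˡ u v r m t with i , p ← hasRPower⁻ u r m t = hasRPower⁺ (RPowerAt-++ˡ v p)

  hasRPower-++ʳ : ∀ {a b} (u : Word a k) (v : Word b k) r m → T (hasRPower v r m) → T (hasRPower (u ++ v) r m)
  hasRPower-++ʳ u v r m t with i , p ← hasRPower⁻ v r m t = hasRPower⁺ (RPowerAt-++ʳ u p)

  maxRPowerLength≡ : ∀ {n} (w : Word n k) r →
                     maxRPowerLength w r ≡ foldr _⊔_ 0 (map (λ m → ind (hasRPower w r m) * m) (upTo (suc n)))
  maxRPowerLength≡ {n} w r = cong (foldr _⊔_ 0) (List.map-cong selected (upTo (suc n)))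
    where
    -- Defs selects the summand with an if-then-else local to maxRPowerLength; it can only be
    -- reached by unfolding, which the Σ-type below does.
    unfolded : Σ[ g ∈ (ℕ → ℕ) ] maxRPowerLength w r ≡ foldr _⊔_ 0 (map g (upTo (suc n)))
    unfolded = _ , refl
    selected : ∀ m → proj₁ unfolded m ≡ ind (hasRPower w r m) * m
    selected m with hasRPower w r m
    ... | true  = sym (+-identityʳ m)
    ... | false = refl

  ≤-maxRPowerLength : ∀ {n} (w : Word n k) s {m} → T (hasRPower w (suc s) m) → m ≤ maxRPowerLength w (suc s)
  ≤-maxRPowerLength {n} w s {m} t with i , p ← hasRPower⁻ w (suc s) m t = begin
    m                                                                          ≡⟨ *-identityˡ m ⟨
    1 * m                                                                      ≤⟨ *-monoˡ-≤ m (ind-mono {true} (λ _ → t)) ⟩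
    ind (hasRPower w (suc s) m) * m                                            ≤⟨ ≤-foldr-⊔ _ id (suc n) (s≤s m≤n) ⟩
    foldr _⊔_ 0 (map (λ m → ind (hasRPower w (suc s) m) * m) (upTo (suc n)))   ≡⟨ maxRPowerLength≡ w (suc s) ⟨
    maxRPowerLength w (suc s)                                                  ∎
    where
    open ≤-Reasoning
    m≤n : m ≤ n
    m≤n = m≤m+n m (s * m) ⟨ ≤-trans ⟩ m≤n+m _ i ⟨ ≤-trans ⟩ RPowerAt.fits p

  maxRPowerLength≤ : ∀ {n} (w : Word n k) r L →
                     maxRPowerLength w r ≤ L + ∑[ m < suc n ] ((m ∸ L) * ind (hasRPower w r m))
  maxRPowerLength≤ {n} w r L = begin
    maxRPowerLength w r                                                 ≡⟨ maxRPowerLength≡ w r ⟩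
    foldr _⊔_ 0 (map (λ m → ind (hasRPower w r m) * m) (upTo (suc n)))  ≤⟨ foldr-⊔≤ _ id (suc n) L ⟩
    L + ∑[ m < suc n ] (ind (hasRPower w r m) * m ∸ L)                  ≡⟨ cong (L +_) (∑-cong (suc n) (λ {m} _ → ind*∸ (hasRPower w r m) m)) ⟩
    L + ∑[ m < suc n ] ((m ∸ L) * ind (hasRPower w r m))                ∎
    where
    open ≤-Reasoning
    ind*∸ : ∀ b m → ind b * m ∸ L ≡ (m ∸ L) * ind b
    ind*∸ true  m = trans (cong (_∸ L) (+-identityʳ m)) (sym (*-identityʳ (m ∸ L)))
    ind*∸ false m = trans (0∸n≡0 L) (sym (*-zeroʳ (m ∸ L)))

  ≤-maxRPowerLength+∑ : ∀ {n} (w : Word n k) s L →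
                        L ≤ maxRPowerLength w (suc s) + ∑[ j < L ] ind (not (hasRPower w (suc s) (suc j)))
  ≤-maxRPowerLength+∑ w s zero = z≤n
  ≤-maxRPowerLength+∑ w s (suc L) with hasRPower w (suc s) (suc L) in has
  ... | true  = ≤-maxRPowerLength w s (subst T (sym has) tt) ⟨ ≤-trans ⟩ m≤m+n _ _
  ... | false = begin
    suc L                        ≡⟨ +-comm 1 L ⟩
    L + 1                        ≤⟨ +-mono-≤ (≤-maxRPowerLength+∑ w s L) (≤-reflexive (cong (ind ∘ not) (sym has))) ⟩
    M + ∑[ j < L ] f j + f L     ≡⟨ +-assoc M _ (f L) ⟩
    M + (∑[ j < L ] f j + f L)   ≡⟨ cong (M +_) (∑-last L f) ⟨
    M + ∑[ j < suc L ] f j       ∎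
    where
    open ≤-Reasoning
    M : ℕ
    M = maxRPowerLength w (suc s)
    f : ℕ → ℕ
    f j = ind (not (hasRPower w (suc s) (suc j)))

-- Counting words subject to comparisons at a fixed offset

data Constraint : Set where
  free agree differ : Constraint

holds : Constraint → Bool → Bool
holds free   _ = true
holds agree  b = b
holds differ b = not b

choices : ℕ → Constraint → ℕ
choices k free   = k
choices k agree  = 1
choices k differ = k ∸ 1

weight : ℕ → List Constraint → ℕ
weight k cs = List.product (map (choices k) cs)

weight-agree : ∀ k l → weight k (replicate l agree) ≡ 1
weight-agree k zero    = refl
weight-agree k (suc l) = trans (+-identityʳ _) (weight-agree k l)

module _ {k : ℕ} where

  satisfies : ∀ {n} → ℕ → List Constraint → Word n k → ℕ → Bool
  satisfies m []       w j = true
  satisfies m (c ∷ cs) w j = holds c (agreesAt m w j) ∧ satisfies m cs w (suc j)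

  satisfies-∷ : ∀ {n} m cs x (w : Word n k) j → satisfies m cs (x ∷ w) (suc j) ≡ satisfies m cs w j
  satisfies-∷ m []       x w j = refl
  satisfies-∷ m (c ∷ cs) x w j = cong (holds c (agreesAt m w j) ∧_) (satisfies-∷ m cs x w (suc j))

  satisfies-agree⁺ : ∀ {n} m l (w : Word n k) j → (∀ {d} → d < l → T (agreesAt m w (j + d))) →
                     T (satisfies m (replicate l agree) w j)
  satisfies-agree⁺ m zero    w j _        = tt
  satisfies-agree⁺ m (suc l) w j agreeing = Equivalence.from T-∧
    ( subst (T ∘ agreesAt m w) (+-identityʳ j) (agreeing z<s)
    , satisfies-agree⁺ m l w (suc j) (λ {d} d<l → subst (T ∘ agreesAt m w) (+-suc j d) (agreeing (s<s d<l))))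

  satisfies-agree⁻ : ∀ {n} m l (w : Word n k) j → T (satisfies m (replicate l agree) w j) →
                     ∀ {d} → d < l → T (agreesAt m w (j + d))
  satisfies-agree⁻ m (suc l) w j t {zero}  _         =
    subst (T ∘ agreesAt m w) (sym (+-identityʳ j)) (proj₁ (Equivalence.to T-∧ t))
  satisfies-agree⁻ m (suc l) w j t {suc d} (s≤s d<l) =
    subst (T ∘ agreesAt m w) (sym (+-suc j d)) (satisfies-agree⁻ m l w (suc j) (proj₂ (Equivalence.to T-∧ t)) d<l)

  sum-holds : ∀ {n} c (w : Word n k) {j} → j < n → sum (λ x → ind (holds c (sameLetter (just x) (letterAt w j)))) ≡ choices k c
  sum-holds free   w j<n = trans (sum-const k 1) (*-identityʳ k)
  sum-holds agree  w j<n with y , wj≡y ← letterAt-just w j<n rewrite wj≡y = sum-ind-≡ y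
  sum-holds differ w j<n with y , wj≡y ← letterAt-just w j<n rewrite wj≡y = sum-ind-≢ y

  -- Each constraint compares a letter with a strictly later one, so once the later letters are
  -- fixed exactly `choices k c` values of the first letter are admissible.
  count-satisfies : ∀ n m′ t cs → t + length cs + suc m′ ≤ n →
                    count n (λ w → satisfies (suc m′) cs w t) * k ^ length cs ≡ weight k cs * k ^ n
  count-satisfies n m′ t [] _ = begin
    wordSum n (λ _ → 1) * 1  ≡⟨ *-identityʳ _ ⟩
    wordSum n (λ _ → 1)      ≡⟨ wordSum-const n 1 ⟩
    k ^ n * 1                ≡⟨ *-comm (k ^ n) 1 ⟩
    1 * k ^ n                ∎
    where open ≡-Reasoning
  count-satisfies zero m′ t (c ∷ cs) fits with () ← m≤n+m (suc m′) (t + suc (length cs)) ⟨ ≤-trans ⟩ fits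
  count-satisfies (suc n) m′ (suc t) cs fits = begin
    count (suc n) (λ w → satisfies m cs w (suc t)) * K  ≡⟨ cong (_* K) shifted ⟩
    k * C * K                                           ≡⟨ *-assoc k C K ⟩
    k * (C * K)                                         ≡⟨ cong (k *_) (count-satisfies n m′ t cs (s≤s⁻¹ fits)) ⟩
    k * (weight k cs * k ^ n)                           ≡⟨ solve 3 (λ x y z → x :* (y :* z) := y :* (x :* z)) refl k (weight k cs) (k ^ n) ⟩
    weight k cs * k ^ suc n                             ∎
    where
    open ≡-Reasoning
    m K C : ℕ
    m = suc m′
    K = k ^ length cs
    C = count n (λ w → satisfies m cs w t)
    shifted : count (suc n) (λ w → satisfies m cs w (suc t)) ≡ k * C
    shifted = trans (sum-cong-≗ (λ x → wordSum-cong n (λ w → cong ind (satisfies-∷ m cs x w t)))) (sum-const k C)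
  count-satisfies (suc n) m′ zero (c ∷ cs) fits = begin
    count (suc n) (λ w → satisfies m (c ∷ cs) w 0) * (k * K)  ≡⟨ cong (_* (k * K)) first-letter ⟩
    choices k c * C * (k * K)                                ≡⟨ solve 4 (λ a b x y → a :* b :* (x :* y) := a :* (b :* y) :* x)
                                                                        refl (choices k c) C k K ⟩
    choices k c * (C * K) * k                                ≡⟨ cong (λ e → choices k c * e * k) (count-satisfies n m′ 0 cs fits′) ⟩
    choices k c * (weight k cs * k ^ n) * k                  ≡⟨ solve 4 (λ a b x y → a :* (b :* y) :* x := a :* b :* (x :* y))
                                                                        refl (choices k c) (weight k cs) k (k ^ n) ⟩
    choices k c * weight k cs * (k * k ^ n)                  ∎
    where
    open ≡-Reasoning
    m K C : ℕ
    m = suc m′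
    K = k ^ length cs
    C = count n (λ w → satisfies m cs w 0)
    fits′ : length cs + m ≤ n
    fits′ = s≤s⁻¹ fits
    holdsAt : Fin k → Word n k → Bool
    holdsAt x w = holds c (sameLetter (just x) (letterAt w m′))
    first-letter : count (suc n) (λ w → satisfies m (c ∷ cs) w 0) ≡ choices k c * C
    first-letter = begin
      sum (λ x → wordSum n (λ w → ind (holdsAt x w ∧ satisfies m cs (x ∷ w) 1)))
        ≡⟨ sum-cong-≗ (λ x → wordSum-cong n (λ w → trans (ind-∧ (holdsAt x w) _)
                                                         (cong (λ b → ind (holdsAt x w) * ind b) (satisfies-∷ m cs x w 0)))) ⟩
      sum (λ x → wordSum n (λ w → ind (holdsAt x w) * ind (satisfies m cs w 0)))
        ≡⟨ wordSum-sum n (λ x w → ind (holdsAt x w) * ind (satisfies m cs w 0)) ⟨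
      wordSum n (λ w → sum (λ x → ind (holdsAt x w) * ind (satisfies m cs w 0)))
        ≡⟨ wordSum-cong n (λ w → trans (sym (*-distribʳ-sum (ind (satisfies m cs w 0)) (λ x → ind (holdsAt x w))))
                                       (cong (_* ind (satisfies m cs w 0)) (sum-holds c w (m≤n+m m (length cs) ⟨ ≤-trans ⟩ fits′)))) ⟩
      wordSum n (λ w → choices k c * ind (satisfies m cs w 0))
        ≡⟨ *-distribˡ-wordSum n (choices k c) _ ⟨
      choices k c * C ∎

-- Counting words with and without r-powers

powerCount : (k n r m : ℕ) → ℕ
powerCount k n r m = count {k} n (λ w → hasRPower w r m)

powerFreeCount : (k n r m : ℕ) → ℕ
powerFreeCount k n r m = count {k} n (λ w → not (hasRPower w r m))

module _ {k : ℕ} where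

  count-isRPowerAt-bound : ∀ n s m′ i → count n (λ w → isRPowerAt w (suc s) (suc m′) i) * k ^ (s * suc m′) ≤ k ^ n
  count-isRPowerAt-bound n s m′ i with i + suc s * suc m′ ≤? n
  ... | no ¬fits = *-monoˡ-≤ (k ^ (s * suc m′)) none ⟨ ≤-trans ⟩ z≤n
    where
    none : count n (λ w → isRPowerAt w (suc s) (suc m′) i) ≤ 0
    none = wordSum-mono n (λ w → ind-mono {b = false} (¬fits ∘ RPowerAt.fits ∘ isRPowerAt⁻ w (suc s) (suc m′) i))
           ⟨ ≤-trans ⟩ ≤-reflexive (trans (wordSum-const n 0) (*-zeroʳ (k ^ n)))
  ... | yes fits = begin
    count n (λ w → isRPowerAt w (suc s) m i) * k ^ l   ≤⟨ *-monoˡ-≤ (k ^ l) (wordSum-mono n (λ w → ind-mono (agreeing w))) ⟩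
    C * k ^ l                                          ≡⟨ cong (λ e → C * k ^ e) (List.length-replicate l) ⟨
    C * k ^ length (replicate l agree)                 ≡⟨ count-satisfies n m′ i (replicate l agree) fits′ ⟩
    weight k (replicate l agree) * k ^ n               ≡⟨ cong (_* k ^ n) (weight-agree k l) ⟩
    1 * k ^ n                                          ≡⟨ *-identityˡ (k ^ n) ⟩
    k ^ n                                              ∎
    where
    open ≤-Reasoning
    m l C : ℕ
    m = suc m′
    l = s * m
    C = count n (λ w → satisfies m (replicate l agree) w i)
    agreeing : ∀ w → T (isRPowerAt w (suc s) m i) → T (satisfies m (replicate l agree) w i)
    agreeing w = satisfies-agree⁺ m l w i ∘ RPowerAt.agrees ∘ isRPowerAt⁻ w (suc s) m i
    fits′ : i + length (replicate l agree) + m ≤ n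
    fits′ = ≤-reflexive (trans (cong (λ e → i + e + m) (List.length-replicate l))
                               (trans (+-assoc i l m) (cong (i +_) (+-comm l m)))) ⟨ ≤-trans ⟩ fits

  powerCount-bound : ∀ n s m′ → powerCount k n (suc s) (suc m′) * k ^ (s * suc m′) ≤ suc n * k ^ n
  powerCount-bound n s m′ = begin
    powerCount k n r m * K                                   ≤⟨ *-monoˡ-≤ K (wordSum-mono n (λ w → ind-any≤∑ (isRPowerAt w r m) id (suc n))) ⟩
    wordSum n (λ w → ∑[ i < suc n ] ind (at i w)) * K         ≡⟨ cong (_* K) (wordSum-∑ n (suc n) (λ i w → ind (at i w))) ⟩
    (∑[ i < suc n ] count n (at i)) * K                      ≡⟨ *-distribʳ-∑ (suc n) K (λ i → count n (at i)) ⟩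
    ∑[ i < suc n ] (count n (at i) * K)                      ≤⟨ ∑-mono (suc n) (λ {i} _ → count-isRPowerAt-bound n s m′ i) ⟩
    ∑[ i < suc n ] (k ^ n)                                   ≡⟨ ∑-const (suc n) (k ^ n) ⟩
    suc n * k ^ n                                            ∎
    where
    open ≤-Reasoning
    r m K : ℕ
    r = suc s
    m = suc m′
    K = k ^ (s * m)
    at : ℕ → Word n k → Bool
    at i w = isRPowerAt w r m i

powerFreeCount-+≤* : ∀ k a b r m → powerFreeCount k (a + b) r m ≤ powerFreeCount k a r m * powerFreeCount k b r m
powerFreeCount-+≤* k a b r m = begin
  wordSum (a + b) (ind ∘ powerFree)                                          ≡⟨ wordSum-++ a b (ind ∘ powerFree) ⟩
  wordSum a (λ u → wordSum b (λ v → ind (powerFree (u ++ v))))               ≤⟨ wordSum-mono a (λ u → wordSum-mono b (split u)) ⟩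
  wordSum a (λ u → wordSum b (λ v → ind (powerFree u) * ind (powerFree v)))  ≡⟨ wordSum-* a b (ind ∘ powerFree) (ind ∘ powerFree) ⟩
  wordSum a (ind ∘ powerFree) * wordSum b (ind ∘ powerFree)                  ∎
  where
  open ≤-Reasoning
  powerFree : ∀ {n} → Word n k → Bool
  powerFree w = not (hasRPower w r m)
  split : ∀ {a b} (u : Word a k) (v : Word b k) → ind (powerFree (u ++ v)) ≤ ind (powerFree u) * ind (powerFree v)
  split u v = ind-mono (λ t → Equivalence.from T-∧ (T-not-mono (hasRPower-++ˡ u v r m) t , T-not-mono (hasRPower-++ʳ u v r m) t))
              ⟨ ≤-trans ⟩ ≤-reflexive (ind-∧ (powerFree u) (powerFree v))

powerFreeCount-*+≤^* : ∀ k q len x r m → powerFreeCount k (q * len + x) r m ≤ powerFreeCount k len r m ^ q * powerFreeCount k x r m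
powerFreeCount-*+≤^* k zero    len x r m = ≤-reflexive (sym (+-identityʳ _))
powerFreeCount-*+≤^* k (suc q) len x r m = begin
  Z (len + q * len + x)       ≡⟨ cong Z (+-assoc len (q * len) x) ⟩
  Z (len + (q * len + x))     ≤⟨ powerFreeCount-+≤* k len (q * len + x) r m ⟩
  Z len * Z (q * len + x)     ≤⟨ *-monoʳ-≤ (Z len) (powerFreeCount-*+≤^* k q len x r m) ⟩
  Z len * (Z len ^ q * Z x)   ≡⟨ *-assoc (Z len) (Z len ^ q) (Z x) ⟨
  Z len * Z len ^ q * Z x     ∎
  where
  open ≤-Reasoning
  Z : ℕ → ℕ
  Z n = powerFreeCount k n r m

module Estimates {k : ℕ} (2≤k : 2 ≤ k) (s : ℕ) .{{_ : NonZero s}} where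

  instance
    k≢0 : NonZero k
    k≢0 = >-nonZero (<-≤-trans z<s 2≤k)
    k∸1≢0 : NonZero (k ∸ 1)
    k∸1≢0 = >-nonZero (∸-monoˡ-≤ 1 2≤k)

  k≤2[k∸1] : k ≤ 2 * (k ∸ 1)
  k≤2[k∸1] = begin
    k                ≡⟨ m∸n+n≡m (<-≤-trans z<s 2≤k) ⟨
    k ∸ 1 + 1        ≤⟨ +-monoʳ-≤ (k ∸ 1) (∸-monoˡ-≤ 1 2≤k) ⟩
    k ∸ 1 + (k ∸ 1)  ≡⟨ cong (k ∸ 1 +_) (+-identityʳ (k ∸ 1)) ⟨
    2 * (k ∸ 1)      ∎
    where open ≤-Reasoning

  2≤k^s : 2 ≤ k ^ s
  2≤k^s = 2≤k ⟨ ≤-trans ⟩ ≤-reflexive (sym (*-identityʳ k)) ⟨ ≤-trans ⟩ ^-monoʳ-≤ k {1} {s} (>-nonZero⁻¹ s)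

  2^j≤k^[s*j] : ∀ j → 2 ^ j ≤ k ^ (s * j)
  2^j≤k^[s*j] j = ^-monoˡ-≤ j 2≤k ⟨ ≤-trans ⟩ ^-monoʳ-≤ k (m≤n*m j s)

  k^[s*]-distrib-+-* : ∀ a b → k ^ (s * (a + b)) ≡ k ^ (s * a) * k ^ (s * b)
  k^[s*]-distrib-+-* a b = trans (cong (k ^_) (*-distribˡ-+ s a b)) (^-distribˡ-+-* k (s * a) (s * b))

  -- event t u: u_t ≠ u_(t+m) but u_j = u_(j+m) for t < j ≤ t + l. It yields an r-power of length m
  -- starting at t + 1, and for t < t′ < m ≤ l the events t and t′ contradict each other at t′.
  module Block (m′ : ℕ) where

    m l len : ℕ
    m   = suc m′
    l   = s * m
    len = m + (m + l)

    event : ℕ → Word len k → Bool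
    event t u = satisfies m (differ ∷ replicate l agree) u t

    event-fits : ∀ {t} → t < m → t + length (differ ∷ replicate l agree) + m ≤ len
    event-fits {t} t<m = begin
      t + suc (length (replicate l agree)) + m  ≡⟨ cong (λ e → t + suc e + m) (List.length-replicate l) ⟩
      t + suc l + m                             ≡⟨ cong (_+ m) (+-suc t l) ⟩
      suc t + l + m                             ≤⟨ +-monoˡ-≤ m (+-monoˡ-≤ l t<m) ⟩
      m + l + m                                 ≡⟨ +-comm (m + l) m ⟩
      len                                       ∎
      where open ≤-Reasoning

    count-event : ∀ {t} → t < m → count len (event t) * k ^ suc l ≡ (k ∸ 1) * k ^ len
    count-event {t} t<m = begin
      count len (event t) * k ^ suc l                                ≡⟨ cong (λ e → count len (event t) * k ^ suc e) (List.length-replicate l) ⟨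
      count len (event t) * k ^ length (differ ∷ replicate l agree)  ≡⟨ count-satisfies {k} len m′ t (differ ∷ replicate l agree) (event-fits t<m) ⟩
      (k ∸ 1) * weight k (replicate l agree) * k ^ len               ≡⟨ cong (λ e → (k ∸ 1) * e * k ^ len) (weight-agree k l) ⟩
      (k ∸ 1) * 1 * k ^ len                                          ≡⟨ cong (_* k ^ len) (*-identityʳ (k ∸ 1)) ⟩
      (k ∸ 1) * k ^ len                                              ∎
      where open ≡-Reasoning

    event⇒hasRPower : ∀ {t} → t < m → ∀ u → T (event t u) → T (hasRPower u (suc s) m)
    event⇒hasRPower {t} t<m u e = hasRPower⁺ {w = u} {r = suc s} {m = m} {i = suc t}
      (+-monoˡ-≤ (m + l) t<m , satisfies-agree⁻ m l u (suc t) (proj₂ (Equivalence.to T-∧ e)))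

    events-disjoint : ∀ {t t′} → t < t′ → t′ < m → ∀ u → T (event t u) → T (event t′ u) → ⊥
    events-disjoint {t} {t′} t<t′ t′<m u e e′ = T-not⇒¬T (proj₁ (Equivalence.to T-∧ e′)) agrees-t′
      where
      gap<l : t′ ∸ suc t < l
      gap<l = m∸n≤m t′ (suc t) ⟨ ≤-<-trans ⟩ t′<m ⟨ <-≤-trans ⟩ m≤n*m m s
      agrees-t′ : T (agreesAt m u t′)
      agrees-t′ = subst (T ∘ agreesAt m u) (m+[n∸m]≡n t<t′) (satisfies-agree⁻ m l u (suc t) (proj₂ (Equivalence.to T-∧ e)) gap<l)

    powerCount-block : m * k ^ len ≤ powerCount k len (suc s) m * (2 * k ^ l)
    powerCount-block = *-cancelˡ-≤ (k ∸ 1) (begin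
      (k ∸ 1) * (m * k ^ len)                       ≡⟨ solve 3 (λ a b c → a :* (b :* c) := b :* (a :* c)) refl (k ∸ 1) m (k ^ len) ⟩
      m * ((k ∸ 1) * k ^ len)                       ≡⟨ ∑-const m _ ⟨
      ∑[ t < m ] ((k ∸ 1) * k ^ len)                ≡⟨ ∑-cong m (λ t<m → sym (count-event t<m)) ⟩
      ∑[ t < m ] (count len (event t) * k ^ suc l)  ≡⟨ *-distribʳ-∑ m (k ^ suc l) (λ t → count len (event t)) ⟨
      (∑[ t < m ] count len (event t)) * k ^ suc l  ≤⟨ *-monoˡ-≤ (k ^ suc l) events≤H ⟩
      H * (k * k ^ l)                               ≤⟨ *-monoʳ-≤ H (*-monoˡ-≤ (k ^ l) k≤2[k∸1]) ⟩
      H * (2 * (k ∸ 1) * k ^ l)                     ≡⟨ solve 3 (λ h a c → h :* (con 2 :* a :* c) := a :* (h :* (con 2 :* c)))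
                                                               refl H (k ∸ 1) (k ^ l) ⟩
      (k ∸ 1) * (H * (2 * k ^ l))                   ∎)
      where
      open ≤-Reasoning
      H : ℕ
      H = powerCount k len (suc s) m
      events≤H : ∑[ t < m ] count len (event t) ≤ H
      events≤H = begin
        ∑[ t < m ] count len (event t)                  ≡⟨ wordSum-∑ len m (λ t → ind ∘ event t) ⟨
        wordSum len (λ u → ∑[ t < m ] ind (event t u))  ≤⟨ wordSum-mono len (λ u → ∑-ind-disjoint m (λ t → event t u)
                                                             (λ t<m → event⇒hasRPower t<m u) (λ t<t′ t′<m → events-disjoint t<t′ t′<m u)) ⟩
        H                                               ∎

    powerFreeCount-block : powerFreeCount k len (suc s) m * (2 * k ^ l) + m * k ^ len ≤ k ^ len * (2 * k ^ l)
    powerFreeCount-block = begin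
      Z * b + m * k ^ len  ≤⟨ +-monoʳ-≤ (Z * b) powerCount-block ⟩
      Z * b + H * b        ≡⟨ *-distribʳ-+ b Z H ⟨
      (Z + H) * b          ≡⟨ cong (_* b) (count-not {k} len (λ u → hasRPower u (suc s) m)) ⟩
      k ^ len * b          ∎
      where
      open ≤-Reasoning
      Z H b : ℕ
      Z = powerFreeCount k len (suc s) m
      H = powerCount k len (suc s) m
      b = 2 * k ^ l

    powerFreeCount-blocks : ∀ n → powerFreeCount k n (suc s) m * (2 * k ^ l + n / len * m) ≤ k ^ n * (2 * k ^ l)
    powerFreeCount-blocks n = begin
      Z n * c                                ≡⟨ cong (λ e → Z e * c) n≡ ⟨
      Z (q * len + x) * c                    ≤⟨ *-monoˡ-≤ c (powerFreeCount-*+≤^* k q len x (suc s) m) ⟩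
      Z len ^ q * Z x * c                    ≤⟨ *-monoˡ-≤ c (*-monoʳ-≤ (Z len ^ q) (count≤ {k} x _)) ⟩
      Z len ^ q * k ^ x * c                  ≡⟨ solve 3 (λ a y c → a :* y :* c := a :* c :* y) refl (Z len ^ q) (k ^ x) c ⟩
      Z len ^ q * c * k ^ x                  ≤⟨ *-monoˡ-≤ (k ^ x) (bernoulli {Z len} {k ^ len} {m} b>0 powerFreeCount-block q) ⟩
      (k ^ len) ^ q * b * k ^ x              ≡⟨ solve 3 (λ a y b → a :* b :* y := a :* y :* b) refl ((k ^ len) ^ q) (k ^ x) b ⟩
      (k ^ len) ^ q * k ^ x * b              ≡⟨ cong (_* b) powers ⟩
      k ^ n * b                              ∎
      where
      open ≤-Reasoning
      q x b c : ℕ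
      q = n / len
      x = n % len
      b = 2 * k ^ l
      c = b + q * m
      Z : ℕ → ℕ
      Z t = powerFreeCount k t (suc s) m
      n≡ : q * len + x ≡ n
      n≡ = trans (+-comm (q * len) x) (sym (m≡m%n+[m/n]*n n len))
      b>0 : 0 < b
      b>0 = m^n>0 k l ⟨ <-≤-trans ⟩ m≤n*m (k ^ l) 2
      powers : (k ^ len) ^ q * k ^ x ≡ k ^ n
      powers = begin-equality
        (k ^ len) ^ q * k ^ x  ≡⟨ cong (_* k ^ x) (^-*-assoc k len q) ⟩
        k ^ (len * q) * k ^ x  ≡⟨ ^-distribˡ-+-* k (len * q) x ⟨
        k ^ (len * q + x)      ≡⟨ cong (λ e → k ^ (e + x)) (*-comm len q) ⟩
        k ^ (q * len + x)      ≡⟨ cong (k ^_) n≡ ⟩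
        k ^ n                  ∎

  powerFreeCount-bound : ∀ n m′ → powerFreeCount k n (suc s) (suc m′) * n ≤ (2 + s) * (k ^ n * (2 * k ^ (s * suc m′)))
  powerFreeCount-bound n m′ = begin
    Z * n                          ≤⟨ *-monoʳ-≤ Z n≤ ⟩
    Z * (suc q * ((2 + s) * m))    ≡⟨ solve 4 (λ z q c m → z :* (q :* (c :* m)) := c :* (z :* (q :* m))) refl Z (suc q) (2 + s) m ⟩
    (2 + s) * (Z * (suc q * m))    ≤⟨ *-monoʳ-≤ (2 + s) (*-monoʳ-≤ Z (+-monoˡ-≤ (q * m) m≤b)) ⟩
    (2 + s) * (Z * (b + q * m))    ≤⟨ *-monoʳ-≤ (2 + s) (powerFreeCount-blocks n) ⟩
    (2 + s) * (k ^ n * b)          ∎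
    where
    open ≤-Reasoning
    open Block m′
    Z q b : ℕ
    Z = powerFreeCount k n (suc s) m
    q = n / len
    b = 2 * k ^ l
    n≤ : n ≤ suc q * len
    n≤ = begin
      n                   ≡⟨ m≡m%n+[m/n]*n n len ⟩
      n % len + q * len   ≤⟨ +-monoˡ-≤ (q * len) (<⇒≤ (m%n<n n len)) ⟩
      len + q * len       ∎
    m≤b : m ≤ b
    m≤b = <⇒≤ (n<2^n m) ⟨ ≤-trans ⟩ ^-monoˡ-≤ m 2≤k ⟨ ≤-trans ⟩ ^-monoʳ-≤ k (m≤n*m m s) ⟨ ≤-trans ⟩ m≤n*m (k ^ l) 2

  powerCount-geometric : ∀ {n L} j → n < k ^ (s * suc L) → powerCount k n (suc s) (suc L + j) * 2 ^ j ≤ k ^ n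
  powerCount-geometric {n} {L} j n<K = *-cancelʳ-≤ _ _ K {{m^n≢0 k (s * suc L)}} (begin
    N * 2 ^ j * K               ≡⟨ solve 3 (λ a b c → a :* b :* c := a :* (c :* b)) refl N (2 ^ j) K ⟩
    N * (K * 2 ^ j)             ≤⟨ *-monoʳ-≤ N (*-monoʳ-≤ K (2^j≤k^[s*j] j)) ⟩
    N * (K * k ^ (s * j))       ≡⟨ cong (N *_) (k^[s*]-distrib-+-* (suc L) j) ⟨
    N * k ^ (s * (suc L + j))   ≤⟨ powerCount-bound n s (L + j) ⟩
    suc n * k ^ n               ≤⟨ *-monoˡ-≤ (k ^ n) n<K ⟩
    K * k ^ n                   ≡⟨ *-comm K (k ^ n) ⟩
    k ^ n * K                   ∎)
    where
    open ≤-Reasoning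
    K N : ℕ
    K = k ^ (s * suc L)
    N = powerCount k n (suc s) (suc L + j)

  powerFreeCount-scaled : ∀ {n} m′ j → k ^ (s * (suc m′ + j)) ≤ n →
                          powerFreeCount k n (suc s) (suc m′) * k ^ (s * j) ≤ 2 * (2 + s) * k ^ n
  powerFreeCount-scaled {n} m′ j fits = *-cancelʳ-≤ _ _ K {{m^n≢0 k (s * suc m′)}} (begin
    Z * k ^ (s * j) * K          ≡⟨ solve 3 (λ a b c → a :* b :* c := a :* (c :* b)) refl Z (k ^ (s * j)) K ⟩
    Z * (K * k ^ (s * j))        ≡⟨ cong (Z *_) (k^[s*]-distrib-+-* (suc m′) j) ⟨
    Z * k ^ (s * (suc m′ + j))   ≤⟨ *-monoʳ-≤ Z fits ⟩
    Z * n                        ≤⟨ powerFreeCount-bound n m′ ⟩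
    (2 + s) * (k ^ n * (2 * K))  ≡⟨ solve 3 (λ c d x → c :* (d :* (con 2 :* x)) := con 2 :* c :* d :* x) refl (2 + s) (k ^ n) K ⟩
    2 * (2 + s) * k ^ n * K      ∎)
    where
    open ≤-Reasoning
    K Z : ℕ
    K = k ^ (s * suc m′)
    Z = powerFreeCount k n (suc s) (suc m′)

  powerFreeCount-geometric : ∀ {n} m′ j → k ^ (s * (suc m′ + j)) ≤ n → powerFreeCount k n (suc s) (suc m′) * 2 ^ j ≤ 8 * k ^ n
  powerFreeCount-geometric {n} m′ zero    _    =
    ≤-reflexive (*-identityʳ _) ⟨ ≤-trans ⟩ count≤ {k} n _ ⟨ ≤-trans ⟩ m≤n*m (k ^ n) 8
  powerFreeCount-geometric {n} m′ (suc j) fits = begin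
    Z * (2 * 2 ^ j)    ≡⟨ solve 2 (λ z p → z :* (con 2 :* p) := con 2 :* (z :* p)) refl Z (2 ^ j) ⟩
    2 * (Z * 2 ^ j)    ≤⟨ *-monoʳ-≤ 2 (*-cancelˡ-≤ (2 ^ s) {{m^n≢0 2 s}} halved) ⟩
    2 * (4 * k ^ n)    ≡⟨ *-assoc 2 4 (k ^ n) ⟨
    8 * k ^ n          ∎
    where
    open ≤-Reasoning
    Z : ℕ
    Z = powerFreeCount k n (suc s) (suc m′)
    halved : 2 ^ s * (Z * 2 ^ j) ≤ 2 ^ s * (4 * k ^ n)
    halved = begin
      2 ^ s * (Z * 2 ^ j)              ≡⟨ solve 3 (λ a z b → a :* (z :* b) := z :* (a :* b)) refl (2 ^ s) Z (2 ^ j) ⟩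
      Z * (2 ^ s * 2 ^ j)              ≤⟨ *-monoʳ-≤ Z (*-mono-≤ (^-monoˡ-≤ s 2≤k) (2^j≤k^[s*j] j)) ⟩
      Z * (k ^ s * k ^ (s * j))        ≡⟨ cong (λ e → Z * (k ^ e * k ^ (s * j))) (*-identityʳ s) ⟨
      Z * (k ^ (s * 1) * k ^ (s * j))  ≡⟨ cong (Z *_) (k^[s*]-distrib-+-* 1 j) ⟨
      Z * k ^ (s * suc j)              ≤⟨ powerFreeCount-scaled m′ (suc j) fits ⟩
      2 * (2 + s) * k ^ n              ≤⟨ *-monoˡ-≤ (k ^ n) (*-monoʳ-≤ 2 (n<2^n (suc s))) ⟩
      2 * (2 * 2 ^ s) * k ^ n          ≡⟨ solve 2 (λ a d → con 2 :* (con 2 :* a) :* d := a :* (con 4 :* d)) refl (2 ^ s) (k ^ n) ⟩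
      2 ^ s * (4 * k ^ n)              ∎

  expectedMax-upper : ∀ {n L} → n < k ^ (s * suc L) → totalMaxRPower n k (suc s) ≤ k ^ n * L + 4 * k ^ n
  expectedMax-upper {n} {L} n<K = begin
    totalMaxRPower n k (suc s)                                        ≡⟨ sum-allWords n (λ w → maxRPowerLength w (suc s)) ⟩
    wordSum n (λ w → maxRPowerLength w (suc s))                       ≤⟨ wordSum-mono n (λ w → maxRPowerLength≤ w (suc s) L) ⟩
    wordSum n (λ w → L + excess w)                                    ≡⟨ wordSum-distrib-+ n (λ _ → L) excess ⟩
    wordSum n (λ _ → L) + wordSum n excess                            ≡⟨ cong₂ _+_ (wordSum-const n L) (wordSum-∑ n (suc n) term) ⟩
    k ^ n * L + ∑[ m < suc n ] wordSum n (term m)                     ≡⟨ cong (k ^ n * L +_) (∑-cong (suc n) (λ {m} _ → counted m)) ⟩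
    k ^ n * L + ∑[ m < suc n ] ((m ∸ L) * powerCount k n (suc s) m)   ≤⟨ +-monoʳ-≤ (k ^ n * L) excess≤ ⟩
    k ^ n * L + 4 * k ^ n                                             ∎
    where
    open ≤-Reasoning
    term : ℕ → Word n k → ℕ
    term m w = (m ∸ L) * ind (hasRPower w (suc s) m)
    excess : Word n k → ℕ
    excess w = ∑[ m < suc n ] term m w
    counted : ∀ m → wordSum n (term m) ≡ (m ∸ L) * powerCount k n (suc s) m
    counted m = sym (*-distribˡ-wordSum n (m ∸ L) (λ w → ind (hasRPower w (suc s) m)))
    excess≤ : ∑[ m < suc n ] ((m ∸ L) * powerCount k n (suc s) m) ≤ 4 * k ^ n
    excess≤ = ∑-∸-geometric L (suc n) (powerCount k n (suc s)) (λ j → powerCount-geometric j n<K)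

  expectedMax-lower : ∀ {n L} → k ^ (s * L) ≤ n → k ^ n * L ≤ totalMaxRPower n k (suc s) + 16 * k ^ n
  expectedMax-lower {n} {L} K≤n = begin
    k ^ n * L                                                    ≡⟨ wordSum-const n L ⟨
    wordSum n (λ _ → L)                                          ≤⟨ wordSum-mono n (λ w → ≤-maxRPowerLength+∑ w s L) ⟩
    wordSum n (λ w → M w + deficit w)                            ≡⟨ wordSum-distrib-+ n M deficit ⟩
    wordSum n M + wordSum n deficit                              ≡⟨ cong (wordSum n M +_) (wordSum-∑ n L missing) ⟩
    wordSum n M + ∑[ j < L ] powerFreeCount k n (suc s) (suc j)  ≤⟨ +-monoʳ-≤ (wordSum n M) deficit≤ ⟩
    wordSum n M + 2 * (8 * k ^ n)                                ≡⟨ cong₂ _+_ (sum-allWords n M) (*-assoc 2 8 (k ^ n)) ⟨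
    totalMaxRPower n k (suc s) + 16 * k ^ n                      ∎
    where
    open ≤-Reasoning
    M deficit : Word n k → ℕ
    M w = maxRPowerLength w (suc s)
    missing : ℕ → Word n k → ℕ
    missing j w = ind (not (hasRPower w (suc s) (suc j)))
    deficit w = ∑[ j < L ] missing j w
    fits : ∀ {i} → i < L → powerFreeCount k n (suc s) (suc i) * 2 ^ (L ∸ suc i) ≤ 8 * k ^ n
    fits {i} i<L = powerFreeCount-geometric i (L ∸ suc i) (subst (λ e → k ^ (s * e) ≤ n) (sym (m+[n∸m]≡n i<L)) K≤n)
    deficit≤ : ∑[ j < L ] powerFreeCount k n (suc s) (suc j) ≤ 2 * (8 * k ^ n)
    deficit≤ = ∑-geometric-reversed L (λ j → powerFreeCount k n (suc s) (suc j)) fits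

  expectedMax-bounds : ∀ {n} → 1 ≤ n →
                       (n ^ (k ^ n) ≤ k ^ (s * (totalMaxRPower n k (suc s) + 17 * k ^ n)))
                       × (k ^ (s * (totalMaxRPower n k (suc s) ∸ 17 * k ^ n)) ≤ n ^ (k ^ n))
  expectedMax-bounds {n} 1≤n with L , K^L≤n , n<K^[1+L] ← ^-bracket (k ^ s) 2≤k^s n 1≤n =
    (^-monoˡ-≤ D (<⇒≤ n<K^[1+L]) ⟨ ≤-trans ⟩ ≤-reflexive (K^[a*D] (suc L)) ⟨ ≤-trans ⟩ ^-monoʳ-≤ k (*-monoʳ-≤ s [1+L]*D≤)) ,
    (^-monoʳ-≤ k (*-monoʳ-≤ s S∸17D≤) ⟨ ≤-trans ⟩ ≤-reflexive (sym (K^[a*D] L)) ⟨ ≤-trans ⟩ ^-monoˡ-≤ D K^L≤n)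
    where
    D S : ℕ
    D = k ^ n
    S = totalMaxRPower n k (suc s)
    K^[a*D] : ∀ a → ((k ^ s) ^ a) ^ D ≡ k ^ (s * (a * D))
    K^[a*D] a = trans (^-*-assoc (k ^ s) a D) (^-*-assoc k s (a * D))
    [1+L]*D≤ : suc L * D ≤ S + 17 * D
    [1+L]*D≤ = +-monoʳ-≤ D (≤-reflexive (*-comm L D)
                            ⟨ ≤-trans ⟩ expectedMax-lower (≤-reflexive (sym (^-*-assoc k s L)) ⟨ ≤-trans ⟩ K^L≤n))
               ⟨ ≤-trans ⟩ ≤-reflexive (solve 2 (λ d t → d :+ (t :+ con 16 :* d) := t :+ con 17 :* d) refl D S)
    S∸17D≤ : S ∸ 17 * D ≤ L * D
    S∸17D≤ = m≤n+o⇒m∸n≤o S (17 * D) (expectedMax-upper (n<K^[1+L] ⟨ <-≤-trans ⟩ ≤-reflexive (^-*-assoc k s (suc L)))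
               ⟨ ≤-trans ⟩ ≤-reflexive (solve 2 (λ d l → d :* l :+ con 4 :* d := con 4 :* d :+ l :* d) refl D L)
               ⟨ ≤-trans ⟩ +-monoˡ-≤ (L * D) (*-monoˡ-≤ D {4} {17} (m≤m+n 4 13)))

corollary2 : ∃[ C ] ((n k r : ℕ) → 1 ≤ n → 2 ≤ k → 2 ≤ r →
               (n ^ (k ^ n) ≤ k ^ ((r ∸ 1) * (totalMaxRPower n k r + C * k ^ n)))
               × (k ^ ((r ∸ 1) * (totalMaxRPower n k r ∸ C * k ^ n)) ≤ n ^ (k ^ n)))
corollary2 = 17 , bounds
  where
  bounds : (n k r : ℕ) → 1 ≤ n → 2 ≤ k → 2 ≤ r →
           (n ^ (k ^ n) ≤ k ^ ((r ∸ 1) * (totalMaxRPower n k r + 17 * k ^ n)))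
           × (k ^ ((r ∸ 1) * (totalMaxRPower n k r ∸ 17 * k ^ n)) ≤ n ^ (k ^ n))
  bounds n k (suc (suc s′)) 1≤n 2≤k (s≤s (s≤s _)) = Estimates.expectedMax-bounds 2≤k (suc s′) 1≤n
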